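{- Let $G$ and $H$ be graphs, let $x_i \in V(G)$, and let $G_i'$ be the graph obtained from $G$ by adding one new vertex $x'$ and the single edge $x_i x'$. For a distribution $D$ on $G_i' \times H$, let $\phi(D)$ be the distribution on $G \times H$ defined by $\phi(D)((x,y)) = D((x,y)) + 2D((x',y))$ if $x = x_i$, and $\phi(D)((x,y)) = D((x,y))$ if $x \neq x_i$. If $D_0$ and $D_n$ are distributions on $G_i' \times H$ such that $D_n$ is reachable from $D_0$ in $G_i'\times H$, then a distribution that contains $\phi(D_n)$ is reachable from $\phi(D_0)$ in $G \times H$.
   Context: Graphs are finite and undirected. A distribution on a graph is a function from its vertex set to $\mathbb{N}$ (numbers of pebbles). A pebbling move removes two pebbles from some vertex and places one pebble on an adjacent vertex. A distribution $D''$ contains $D'$ if $D'(v)\le D''(v)$ for every vertex $v$; $D'$ is reachable from $D$ if a sequence of pebbling moves leads from $D$ to a distribution containing $D'$. The Cartesian product $G\times H$ has vertex set $V(G)\times V(H)$, with $(x,y)$ adjacent to $(x,y')$ when $yy' \in E(H)$ and to $(x',y)$ when $xx' \in E(G)$. -}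

module Defs where

open import Data.Nat using (ℕ; _+_; _*_; _≤_)
open import Data.Fin using (Fin)
import Data.Maybe
import Function.Bundles
import Data.Maybe.Properties
import Data.Product.Properties
import Relation.Binary.PropositionalEquality
open import Data.Maybe using (Maybe; just; nothing)
open import Data.Product using (_×_; _,_; Σ; proj₁; proj₂)
open import Data.Sum using (_⊎_)
open import Data.Empty using (⊥)
open import Relation.Nullary using (¬_; Dec; yes; no)
open import Relation.Binary.PropositionalEquality using (_≡_)
open import Relation.Binary.Definitions using (DecidableEquality)
open import Relation.Binary.Construct.Closure.ReflexiveTransitive using (Star)
open import Function.Bundles using (_↔_; mk↔ₛ′)
open import Function.Properties.Inverse using (↔-trans; ↔-sym)
open import Data.Product.Function.NonDependent.Propositional using (_×-↔_)
open import Data.Fin using (zero; suc)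
open import Data.Fin.Properties using (*↔×)
open import Data.Nat using (suc)
open import Relation.Binary.PropositionalEquality using (refl)

record Graph : Set₁ where
  field
    V      : Set
    size   : ℕ
    finite : V ↔ Fin size
    _≟V_   : DecidableEquality V
    Adj    : V → V → Set
    adjSym : ∀ {u v} → Adj u v → Adj v u
    irrefl : ∀ {u} → ¬ Adj u u
open Graph public

-- Distributions: number of pebbles on each vertex.
Distribution : Graph → Set
Distribution G = V G → ℕ

record Move (G : Graph) (D D' : Distribution G) : Set where
  field
    from to : V G
    adj     : Adj G from to
    atFrom  : D' from + 2 ≡ D from
    atTo    : D' to ≡ D to + 1
    others  : ∀ w → ¬ w ≡ from → ¬ w ≡ to → D' w ≡ D w

Moves : (G : Graph) → Distribution G → Distribution G → Set
Moves G = Star (Move G)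

Contains : (G : Graph) → Distribution G → Distribution G → Set
Contains G D'' D' = ∀ v → D' v ≤ D'' v

Reachable : (G : Graph) → Distribution G → Distribution G → Set
Reachable G D D' = Σ (Distribution G) λ D'' → Moves G D D'' × Contains G D'' D'

ProdAdj : (G H : Graph) → (V G × V H) → (V G × V H) → Set
ProdAdj G H (x , y) (x' , y') = (x ≡ x' × Adj H y y') ⊎ (Adj G x x' × y ≡ y')

prodFinite : (G H : Graph) → (V G × V H) ↔ Fin (size G * size H)
prodFinite G H = ↔-trans (finite G ×-↔ finite H) (↔-sym *↔×)

_×G_ : Graph → Graph → Graph
G ×G H = record
  { V      = V G × V H
  ; size   = size G * size H
  ; finite = prodFinite G H
  ; _≟V_   = Data.Product.Properties.≡-dec (_≟V_ G) (_≟V_ H)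
  ; Adj    = ProdAdj G H
  ; adjSym = λ {u} {v} → sy {u} {v}
  ; irrefl = λ {u} → irr {u}
  }
  where
  sy : ∀ {u v} → ProdAdj G H u v → ProdAdj G H v u
  sy (_⊎_.inj₁ (refl , a)) = _⊎_.inj₁ (refl , adjSym H a)
  sy (_⊎_.inj₂ (a , refl)) = _⊎_.inj₂ (adjSym G a , refl)
  irr : ∀ {u} → ¬ ProdAdj G H u u
  irr (_⊎_.inj₁ (_ , a)) = irrefl H a
  irr (_⊎_.inj₂ (a , _)) = irrefl G a

private
  toM : ∀ {k} → Fin (suc k) → Maybe (Fin k)
  toM zero = nothing
  toM (suc i) = just i
  fromM : ∀ {k} → Maybe (Fin k) → Fin (suc k)
  fromM nothing = zero
  fromM (just i) = suc i
  finMaybe : ∀ {k} → Maybe (Fin k) ↔ Fin (suc k)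
  finMaybe = mk↔ₛ′ fromM toM
    (λ { zero → refl ; (suc i) → refl })
    (λ { nothing → refl ; (just i) → refl })

-- Adjacency of G'_i: G plus a new vertex x' (= nothing) joined only to xi.
ExtAdj : (G : Graph) → V G → Maybe (V G) → Maybe (V G) → Set
ExtAdj G xi (just a) (just b) = Adj G a b
ExtAdj G xi (just a) nothing  = a ≡ xi
ExtAdj G xi nothing  (just b) = b ≡ xi
ExtAdj G xi nothing  nothing  = ⊥

extend : (G : Graph) → V G → Graph
extend G xi = record
  { V      = Maybe (V G)
  ; size   = suc (size G)
  ; finite = ↔-trans (mk↔ₛ′ (Data.Maybe.map (Function.Bundles.Inverse.to (finite G))) (Data.Maybe.map (Function.Bundles.Inverse.from (finite G))) invl invr) finMaybe
  ; _≟V_   = Data.Maybe.Properties.≡-dec (_≟V_ G)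
  ; Adj    = ExtAdj G xi
  ; adjSym = λ {u} {v} → sy {u} {v}
  ; irrefl = λ {u} → irr {u}
  }
  where
  open import Data.Maybe using (map)
  invl : ∀ y → Data.Maybe.map (Function.Bundles.Inverse.to (finite G)) (Data.Maybe.map (Function.Bundles.Inverse.from (finite G)) y) ≡ y
  invl nothing = refl
  invl (just y) = Relation.Binary.PropositionalEquality.cong just (Function.Bundles.Inverse.strictlyInverseˡ (finite G) y)
  invr : ∀ x → Data.Maybe.map (Function.Bundles.Inverse.from (finite G)) (Data.Maybe.map (Function.Bundles.Inverse.to (finite G)) x) ≡ x
  invr nothing = refl
  invr (just x) = Relation.Binary.PropositionalEquality.cong just (Function.Bundles.Inverse.strictlyInverseʳ (finite G) x)
  sy : ∀ {u v} → ExtAdj G xi u v → ExtAdj G xi v u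
  sy {just a} {just b} e = adjSym G e
  sy {just a} {nothing} e = e
  sy {nothing} {just b} e = e
  sy {nothing} {nothing} ()
  irr : ∀ {u} → ¬ ExtAdj G xi u u
  irr {just a} e = irrefl G e
  irr {nothing} ()

φ : (G H : Graph) (xi : V G) → Distribution (extend G xi ×G H) → Distribution (G ×G H)
φ G H xi D (x , y) with _≟V_ G x xi
... | yes _ = D (just x , y) + 2 * D (nothing , y)
... | no  _ = D (just x , y)

module Submission where

-- A pebbling move on G'ᵢ × H is simulated in G × H after
-- "folding" the pendant column {x'} × H onto the column {xᵢ} × H, where
-- a pebble on (x', y) is worth two pebbles on (xᵢ, y); this is the map φ.
--   * a move inside the copy of G × H is performed verbatim;
--   * a move (x', y) → (x', y') is simulated by two moves (xᵢ, y) → (xᵢ, y');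
--   * a move between (xᵢ, y) and (x', y) never increases any value of φ,
--     so it is simulated by doing nothing.  A map on
-- distributions that simulates single moves then simulates move sequences.

open import Defs
open import Data.Nat
open import Data.Nat.Properties
open import Data.Nat.Tactic.RingSolver using (solve-∀)
open import Data.Maybe using (just; nothing)
open import Data.Product using (Σ; _×_; _,_; proj₁; proj₂)
open import Data.Sum using (inj₁; inj₂)
open import Data.Empty using (⊥-elim)
open import Relation.Nullary using (¬_; yes; no)
open import Relation.Binary.PropositionalEquality
open import Relation.Binary.Construct.Closure.ReflexiveTransitive using (ε; _◅_; _◅◅_)

Unchanged : (L : Graph) → Distribution L → Distribution L → V L → V L → Set
Unchanged L A B u v = ∀ w → ¬ w ≡ u → ¬ w ≡ v → B w ≡ A w

module Pebbling (L : Graph) where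

  applyMove : (A : Distribution L) {u v : V L} → Adj L u v → 2 ≤ A u →
              Σ (Distribution L) (Move L A)
  applyMove A {u} {v} uv 2≤Au = B , record
    { from = u ; to = v ; adj = uv ; atFrom = atFrom ; atTo = atTo ; others = others }
    where
    B : Distribution L
    B w with _≟V_ L w u
    ... | yes _ = A u ∸ 2
    ... | no _ with _≟V_ L w v
    ...   | yes _ = A v + 1
    ...   | no _ = A w
    atFrom : B u + 2 ≡ A u
    atFrom with _≟V_ L u u
    ... | yes _ = m∸n+n≡m 2≤Au
    ... | no u≢u = ⊥-elim (u≢u refl)
    atTo : B v ≡ A v + 1
    atTo with _≟V_ L v u
    ... | yes refl = ⊥-elim (irrefl L uv)
    ... | no _ with _≟V_ L v v
    ...   | yes _ = refl
    ...   | no v≢v = ⊥-elim (v≢v refl)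
    others : Unchanged L A B u v
    others w w≢u w≢v with _≟V_ L w u
    ... | yes w≡u = ⊥-elim (w≢u w≡u)
    ... | no _ with _≟V_ L w v
    ...   | yes w≡v = ⊥-elim (w≢v w≡v)
    ...   | no _ = refl

  move-dominates : ∀ {A B C : Distribution L} (mv : Move L A B) →
    let open Move mv in
    2 + C from ≤ A from → C to ≤ 1 + A to →
    (∀ w → ¬ w ≡ from → ¬ w ≡ to → C w ≤ A w) → Contains L B C
  move-dominates {A} {B} {C} mv atU atV elsewhere w with _≟V_ L w (Move.from mv)
  ... | yes refl = +-cancelˡ-≤ 2 (C w) (B w)
                     (≤-trans atU (≤-reflexive (trans (sym (Move.atFrom mv)) (+-comm (B w) 2))))
  ... | no w≢u with _≟V_ L w (Move.to mv)
  ...   | yes refl = ≤-trans atV (≤-reflexive (trans (+-comm 1 (A w)) (sym (Move.atTo mv))))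
  ...   | no w≢v = ≤-trans (elsewhere w w≢u w≢v) (≤-reflexive (sym (Move.others mv w w≢u w≢v)))

  move-mono : ∀ {A A' B : Distribution L} → Move L A B → Contains L A' A →
              Σ (Distribution L) λ B' → Move L A' B' × Contains L B' B
  move-mono {A} {A'} {B} mv A⊆A' = B' , mv' , move-dominates mv' atU atV elsewhere
    where
    open Move mv
    2+B≡A : 2 + B from ≡ A from
    2+B≡A = trans (+-comm 2 (B from)) atFrom
    atU : 2 + B from ≤ A' from
    atU = ≤-trans (≤-reflexive 2+B≡A) (A⊆A' from)
    replay = applyMove A' adj (≤-trans (m≤m+n 2 (B from)) atU)
    B' = proj₁ replay
    mv' = proj₂ replay
    atV : B to ≤ 1 + A' to
    atV = ≤-trans (≤-reflexive (trans atTo (+-comm (A to) 1))) (+-monoʳ-≤ 1 (A⊆A' to))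
    elsewhere : ∀ w → ¬ w ≡ from → ¬ w ≡ to → B w ≤ A' w
    elsewhere w w≢u w≢v = ≤-trans (≤-reflexive (others w w≢u w≢v)) (A⊆A' w)

  moves-mono : ∀ {A A' B : Distribution L} → Moves L A B → Contains L A' A →
               Reachable L A' B
  moves-mono ε A⊆A' = _ , ε , A⊆A'
  moves-mono (mv ◅ mvs) A⊆A' with move-mono mv A⊆A'
  ... | B' , mv' , B⊆B' with moves-mono mvs B⊆B'
  ...   | C' , mvs' , C⊆C' = C' , mv' ◅ mvs' , C⊆C'

  contained-reachable : ∀ {A C : Distribution L} → Contains L A C → Reachable L A C
  contained-reachable A⊇C = _ , ε , A⊇C

  -- Reachability is transitive, because the moves of the second leg can be
  -- replayed from the larger distribution where the first leg ends.
  reachable-trans : ∀ {A B C : Distribution L} →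
                    Reachable L A B → Reachable L B C → Reachable L A C
  reachable-trans (A' , mvs , B⊆A') (B' , mvs' , C⊆B') with moves-mono mvs' B⊆A'
  ... | C' , mvs'' , B'⊆C' = C' , mvs ◅◅ mvs'' , λ w → ≤-trans (C⊆B' w) (B'⊆C' w)

  reach-by-move : ∀ {A C : Distribution L} {u v : V L} → Adj L u v →
    2 + C u ≤ A u → C v ≤ 1 + A v → (∀ w → ¬ w ≡ u → ¬ w ≡ v → C w ≤ A w) →
    Reachable L A C
  reach-by-move {A} {C} {u} uv atU atV elsewhere =
    proj₁ step , proj₂ step ◅ ε , move-dominates (proj₂ step) atU atV elsewhere
    where
    step = applyMove A uv (≤-trans (m≤m+n 2 (C u)) atU)

  reach-by-two-moves : ∀ {A C : Distribution L} {u v : V L} → Adj L u v →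
    4 + C u ≤ A u → C v ≤ 2 + A v → (∀ w → ¬ w ≡ u → ¬ w ≡ v → C w ≤ A w) →
    Reachable L A C
  reach-by-two-moves {A} {C} {u} {v} uv atU atV elsewhere =
    proj₁ rest , mv ◅ proj₁ (proj₂ rest) , proj₂ (proj₂ rest)
    where
    step = applyMove A uv (≤-trans (m≤m+n 2 (2 + C u)) atU)
    B = proj₁ step
    mv = proj₂ step
    atU' : 2 + C u ≤ B u
    atU' = +-cancelʳ-≤ 2 (2 + C u) (B u)
             (≤-trans (≤-reflexive (+-comm (2 + C u) 2)) (≤-trans atU (≤-reflexive (sym (Move.atFrom mv)))))
    atV' : C v ≤ 1 + B v
    atV' = ≤-trans atV (≤-reflexive (cong suc (trans (+-comm 1 (A v)) (sym (Move.atTo mv)))))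
    elsewhere' : ∀ w → ¬ w ≡ u → ¬ w ≡ v → C w ≤ B w
    elsewhere' w w≢u w≢v = ≤-trans (elsewhere w w≢u w≢v) (≤-reflexive (sym (Move.others mv w w≢u w≢v)))
    rest : Reachable L B C
    rest = reach-by-move uv atU' atV' elsewhere'

open Pebbling

simulate-moves : (K L : Graph) (Φ : Distribution K → Distribution L) →
  (∀ {D D'} → Move K D D' → Reachable L (Φ D) (Φ D')) →
  ∀ {D D'} → Moves K D D' → Reachable L (Φ D) (Φ D')
simulate-moves K L Φ simulate-move ε = contained-reachable L (λ _ → ≤-refl)
simulate-moves K L Φ simulate-move (mv ◅ mvs) =
  reachable-trans L (simulate-move mv) (simulate-moves K L Φ simulate-move mvs)

-- Arithmetic of the weight a + 2n of a pair (xi, y), (x', y) carrying a and n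
-- pebbles, under the changes caused by moves touching the pair.
pendant-gains-two : ∀ a n → 4 + (a + 2 * n) ≡ a + 2 * (n + 2)
pendant-gains-two = solve-∀

pendant-gains-one : ∀ a n → a + 2 * (n + 1) ≡ 2 + (a + 2 * n)
pendant-gains-one = solve-∀

pendant-to-copy-weight : ∀ a n → 3 + ((a + 1) + 2 * n) ≡ a + 2 * (n + 2)
pendant-to-copy-weight = solve-∀

copy-to-pendant-weight : ∀ a n → a + 2 * (n + 1) ≡ (a + 2) + 2 * n
copy-to-pendant-weight = solve-∀

pendant-to-copy : ∀ a n a' n' → a' ≡ a + 1 → n' + 2 ≡ n → a' + 2 * n' ≤ a + 2 * n
pendant-to-copy a n a' n' refl refl =
  ≤-trans (m≤n+m _ 3) (≤-reflexive (pendant-to-copy-weight a n'))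

copy-to-pendant : ∀ a n a' n' → a' + 2 ≡ a → n' ≡ n + 1 → a' + 2 * n' ≡ a + 2 * n
copy-to-pendant a n a' n' refl refl = copy-to-pendant-weight a' n

module Folding (G H : Graph) (xi : V G) where

  K' = extend G xi ×G H
  K  = G ×G H
  Φ  = φ G H xi

  φ-at-xi : ∀ (D : Distribution K') y → Φ D (xi , y) ≡ D (just xi , y) + 2 * D (nothing , y)
  φ-at-xi D y with _≟V_ G xi xi
  ... | yes _ = refl
  ... | no xi≢xi = ⊥-elim (xi≢xi refl)

  φ-compare : ∀ (D D' : Distribution K') x z k m →
    k + D' (just x , z) ≤ m + D (just x , z) →
    (x ≡ xi → D' (nothing , z) ≤ D (nothing , z)) →
    k + Φ D' (x , z) ≤ m + Φ D (x , z)
  φ-compare D D' x z k m copy pendant with _≟V_ G x xi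
  ... | no _ = copy
  ... | yes x≡xi = begin
    k + (D' (just x , z) + 2 * D' (nothing , z)) ≡⟨ sym (+-assoc k _ _) ⟩
    (k + D' (just x , z)) + 2 * D' (nothing , z) ≤⟨ +-mono-≤ copy (*-monoʳ-≤ 2 (pendant x≡xi)) ⟩
    (m + D (just x , z)) + 2 * D (nothing , z)   ≡⟨ +-assoc m _ _ ⟩
    m + (D (just x , z) + 2 * D (nothing , z))   ∎
    where open ≤-Reasoning

  φ-mono : ∀ {D D' : Distribution K'} → Contains K' D D' → Contains K (Φ D) (Φ D')
  φ-mono D⊇D' (x , z) = φ-compare _ _ x z 0 0 (D⊇D' (just x , z)) (λ _ → D⊇D' (nothing , z))

  copy-≢ : ∀ {x a : V G} {z y : V H} → ¬ (x , z) ≡ (a , y) →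
           ¬ _≡_ {A = V K'} (just x , z) (just a , y)
  copy-≢ ne refl = ne refl

  move-in-copy : ∀ {D D' : Distribution K'} {a b y y'} → Adj K (a , y) (b , y') →
    D' (just a , y) + 2 ≡ D (just a , y) → D' (just b , y') ≡ D (just b , y') + 1 →
    Unchanged K' D D' (just a , y) (just b , y') → Reachable K (Φ D) (Φ D')
  move-in-copy {D} {D'} {a} {b} {y} {y'} adj atFrom atTo others =
    reach-by-move K adj atU atV elsewhere
    where
    pendant : ∀ z → D' (nothing , z) ≤ D (nothing , z)
    pendant z = ≤-reflexive (others (nothing , z) (λ ()) (λ ()))
    atU : 2 + Φ D' (a , y) ≤ Φ D (a , y)
    atU = φ-compare D D' a y 2 0 (≤-reflexive (trans (+-comm 2 _) atFrom)) (λ _ → pendant y)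
    atV : Φ D' (b , y') ≤ 1 + Φ D (b , y')
    atV = φ-compare D D' b y' 0 1 (≤-reflexive (trans atTo (+-comm _ 1))) (λ _ → pendant y')
    elsewhere : ∀ w → ¬ w ≡ (a , y) → ¬ w ≡ (b , y') → Φ D' w ≤ Φ D w
    elsewhere (x , z) ≢u ≢v = φ-compare D D' x z 0 0
      (≤-reflexive (others (just x , z) (copy-≢ ≢u) (copy-≢ ≢v))) (λ _ → pendant z)

  move-in-pendant : ∀ {D D' : Distribution K'} {y y'} → Adj H y y' →
    D' (nothing , y) + 2 ≡ D (nothing , y) → D' (nothing , y') ≡ D (nothing , y') + 1 →
    Unchanged K' D D' (nothing , y) (nothing , y') → Reachable K (Φ D) (Φ D')
  move-in-pendant {D} {D'} {y} {y'} adj atFrom atTo others =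
    reach-by-two-moves K (inj₁ (refl , adj)) atU atV elsewhere
    where
    copyXi : ∀ z → D' (just xi , z) ≡ D (just xi , z)
    copyXi z = others (just xi , z) (λ ()) (λ ())
    atU : 4 + Φ D' (xi , y) ≤ Φ D (xi , y)
    atU = ≤-reflexive (begin
      4 + Φ D' (xi , y)                              ≡⟨ cong (4 +_) (φ-at-xi D' y) ⟩
      4 + (D' (just xi , y) + 2 * D' (nothing , y))  ≡⟨ pendant-gains-two (D' (just xi , y)) (D' (nothing , y)) ⟩
      D' (just xi , y) + 2 * (D' (nothing , y) + 2)  ≡⟨ cong₂ (λ a n → a + 2 * n) (copyXi y) atFrom ⟩
      D (just xi , y) + 2 * D (nothing , y)          ≡⟨ sym (φ-at-xi D y) ⟩
      Φ D (xi , y)                                   ∎)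
      where open ≡-Reasoning
    atV : Φ D' (xi , y') ≤ 2 + Φ D (xi , y')
    atV = ≤-reflexive (begin
      Φ D' (xi , y')                                  ≡⟨ φ-at-xi D' y' ⟩
      D' (just xi , y') + 2 * D' (nothing , y')       ≡⟨ cong₂ (λ a n → a + 2 * n) (copyXi y') atTo ⟩
      D (just xi , y') + 2 * (D (nothing , y') + 1)   ≡⟨ pendant-gains-one (D (just xi , y')) (D (nothing , y')) ⟩
      2 + (D (just xi , y') + 2 * D (nothing , y'))   ≡⟨ cong (2 +_) (sym (φ-at-xi D y')) ⟩
      2 + Φ D (xi , y')                               ∎)
      where open ≡-Reasoning
    elsewhere : ∀ w → ¬ w ≡ (xi , y) → ¬ w ≡ (xi , y') → Φ D' w ≤ Φ D w
    elsewhere (x , z) ≢u ≢v = φ-compare D D' x z 0 0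
      (≤-reflexive (others (just x , z) (λ ()) (λ ())))
      (λ { refl → ≤-reflexive (others (nothing , z) (λ { refl → ≢u refl }) (λ { refl → ≢v refl })) })

  move-on-pendant-edge : ∀ {D D' : Distribution K'} {y} →
    D' (just xi , y) + 2 * D' (nothing , y) ≤ D (just xi , y) + 2 * D (nothing , y) →
    Unchanged K' D D' (just xi , y) (nothing , y) → Reachable K (Φ D) (Φ D')
  move-on-pendant-edge {D} {D'} {y} weight others = contained-reachable K decrease
    where
    decrease : Contains K (Φ D) (Φ D')
    decrease (x , z) with _≟V_ K (x , z) (xi , y)
    ... | yes refl = subst₂ _≤_ (sym (φ-at-xi D' y)) (sym (φ-at-xi D y)) weight
    ... | no ne = φ-compare D D' x z 0 0
      (≤-reflexive (others (just x , z) (copy-≢ ne) (λ ())))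
      (λ { refl → ≤-reflexive (others (nothing , z) (λ ()) (λ { refl → ne refl })) })

  simulate-move : ∀ {D D' : Distribution K'} → Move K' D D' → Reachable K (Φ D) (Φ D')
  simulate-move record { from = just a , y ; to = just b , y' ; adj = inj₁ (refl , adj) ; atFrom = af ; atTo = at ; others = ot } =
    move-in-copy (inj₁ (refl , adj)) af at ot
  simulate-move record { from = just a , y ; to = just b , y' ; adj = inj₂ (adj , refl) ; atFrom = af ; atTo = at ; others = ot } =
    move-in-copy (inj₂ (adj , refl)) af at ot
  simulate-move record { from = nothing , y ; to = nothing , y' ; adj = inj₁ (_ , adj) ; atFrom = af ; atTo = at ; others = ot } =
    move-in-pendant adj af at ot
  simulate-move record { from = nothing , y ; to = nothing , y' ; adj = inj₂ (() , _) }
  simulate-move record { from = nothing , y ; to = just .xi , .y ; adj = inj₂ (refl , refl) ; atFrom = af ; atTo = at ; others = ot } =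
    move-on-pendant-edge (pendant-to-copy _ _ _ _ at af) (λ w ≢u ≢v → ot w ≢v ≢u)
  simulate-move record { from = nothing , y ; to = just b , y' ; adj = inj₁ (() , _) }
  simulate-move record { from = just .xi , y ; to = nothing , .y ; adj = inj₂ (refl , refl) ; atFrom = af ; atTo = at ; others = ot } =
    move-on-pendant-edge (≤-reflexive (copy-to-pendant _ _ _ _ af at)) ot
  simulate-move record { from = just a , y ; to = nothing , y' ; adj = inj₁ (() , _) }

proposition3p3 : (G H : Graph) (xi : V G)
                 (D₀ Dₙ : Distribution (extend G xi ×G H)) →
                 Reachable (extend G xi ×G H) D₀ Dₙ →
                 Reachable (G ×G H) (φ G H xi D₀) (φ G H xi Dₙ)
proposition3p3 G H xi D₀ Dₙ (D , moves , D⊇Dₙ) =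
  reachable-trans K (simulate-moves K' K Φ simulate-move moves)
                    (contained-reachable K (φ-mono D⊇Dₙ))
  where open Folding G H xi
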